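{- Let $\theta = p/q \in (0,1]$, where $p$ and $q$ are positive integers such that $p$ divides $q+1$, and let $(a_i)_{i=1}^{\infty}$ be the infinite greedy underapproximation sequence of $\theta$. Then \[ a_1 = \frac{q+1}{p} \] and, for all $k \geq 1$, \[ a_{k+1} = q\prod_{i=1}^k a_i + 1 \qquad\text{and}\qquad \frac{p}{q} = \sum_{i=1}^k \frac{1}{a_i} + \frac{1}{q\prod_{i=1}^k a_i}. \]
   Context: For $\theta \in (0,1]$ let $G(\theta) = \lfloor 1/\theta \rfloor + 1$; equivalently $G(\theta)$ is the unique integer $a \geq 2$ with $1/a < \theta \leq 1/(a-1)$. The infinite greedy underapproximation sequence $(a_i)_{i=1}^\infty$ of $\theta\in(0,1]$ is defined by $a_1 = G(\theta)$ and $a_{i+1} = G\left(\theta - \sum_{j=1}^i \frac{1}{a_j}\right)$ for all $i \geq 1$. -}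

module Defs where

open import Data.Nat as ℕ using (ℕ; zero; suc)
open import Data.Integer as ℤ using (ℤ; +_; +[1+_])
open import Data.Rational as ℚ using (ℚ; mkℚ; 1/_; floor; _-_; _+_; _/_)

-- G θ = ⌊ 1/θ ⌋ + 1 for θ > 0 (θ = mkℚ +[1+ n ] d _ is exactly the positive case);
-- for θ ≤ 0 the value is irrelevant junk (0), never used for θ ∈ (0,1].
G : ℚ → ℕ
G θ@(mkℚ +[1+ n ] d c) = ℤ.∣ floor (1/ θ) ∣ ℕ.+ 1
G _ = 0

inv : ℕ → ℚ
inv zero = ℚ.0ℚ
inv (suc a) = + 1 / suc a

rem : ℚ → ℕ → ℚ
-- greedy sequence, 1-indexed: greedy θ (suc i) = a_{i+1} = G (rem θ i); greedy θ 0 is junk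
greedy : ℚ → ℕ → ℕ

rem θ zero = θ
rem θ (suc i) = rem θ i - inv (greedy θ (suc i))
greedy θ zero = 0
greedy θ (suc i) = G (rem θ i)

sumInv : ℚ → ℕ → ℚ
sumInv θ zero = ℚ.0ℚ
sumInv θ (suc k) = sumInv θ k + inv (greedy θ (suc k))

prodA : ℚ → ℕ → ℕ
prodA θ zero = 1
prodA θ (suc k) = prodA θ k ℕ.* greedy θ (suc k)

-- If p m = q + 1 then p and q are coprime and ⌊q/p⌋ = m − 1, so the greedy algorithm
-- picks a₁ = m, and the remainder p/q − 1/m = 1/(qm) is a unit fraction. From a unit
-- fraction 1/N the greedy algorithm picks N + 1 and leaves 1/N − 1/(N+1) = 1/(N(N+1)),
-- again a unit fraction. By induction the remainder after k steps is 1/(q a₁⋯a_k),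
-- which gives both formulas.
module Submission where

open import Defs
open import Data.Nat using (ℕ; zero; suc; pred; _+_; _*_; _∸_; _≤_; _/_; NonZero)
open import Data.Nat.Properties
  using ( suc-injective; +-comm; +-identityʳ; *-comm; *-assoc; *-identityˡ; *-identityʳ
        ; n<1+n; n≤1+n; m+n∸n≡m; m*n≢0; m*n≢0⇒m≢0 )
open import Data.Nat.DivMod using (+-distrib-/-∣ʳ; m<n⇒m/n≡0; m*n/n≡m)
open import Data.Nat.Divisibility using (_∣_; divides; ∣-trans; n∣m*n; ∣m+n∣m⇒∣n; ∣1⇒≡1)
open import Data.Nat.Coprimality using (Coprime)
open import Data.Integer as ℤ using (+_; +[1+_]; _⊖_)
import Data.Integer.Properties as ℤP
open import Data.Rational using (ℚ; mkℚ; _-_; -_; toℚᵘ; fromℚᵘ) renaming (_/_ to _/ℚ_; _+_ to _+ℚ_)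
import Data.Rational.Properties as ℚP
open import Data.Rational.Unnormalised as ℚᵘ using (mkℚᵘ; *≡*)
import Data.Rational.Unnormalised.Properties as ℚᵘP
open import Algebra.Properties.AbelianGroup ℚP.+-0-abelianGroup using (xyx⁻¹≈y)
open import Data.Product using (_×_; _,_; proj₁; proj₂)
open import Relation.Binary.PropositionalEquality
  using (_≡_; sym; trans; cong; cong₂; subst; module ≡-Reasoning)

∣1+n⇒coprime : ∀ {m n} → m ∣ suc n → Coprime m n
∣1+n⇒coprime {n = n} m∣1+n {d} (d∣m , d∣n) =
  ∣1⇒≡1 (∣m+n∣m⇒∣n (subst (d ∣_) (+-comm 1 n) (∣-trans d∣m m∣1+n)) d∣n)

1+n≡m*d⇒n/d+1≡m : ∀ {m n d} .{{_ : NonZero d}} → suc n ≡ m * d → n / d + 1 ≡ m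
1+n≡m*d⇒n/d+1≡m {suc m} {n} {suc d} eq = begin
  n / suc d + 1                     ≡⟨ cong (λ k → k / suc d + 1) (suc-injective eq) ⟩
  (d + m * suc d) / suc d + 1       ≡⟨ cong (_+ 1) (+-distrib-/-∣ʳ d (n∣m*n m)) ⟩
  d / suc d + m * suc d / suc d + 1 ≡⟨ cong₂ (λ a b → a + b + 1) (m<n⇒m/n≡0 (n<1+n d)) (m*n/n≡m m (suc d)) ⟩
  m + 1                             ≡⟨ +-comm m 1 ⟩
  suc m                             ∎
  where open ≡-Reasoning

G-mkℚ : ∀ n d .(c : Coprime (suc n) (suc d)) → G (mkℚ +[1+ n ] d c) ≡ suc d / suc n + 1
G-mkℚ n d c = cong (_+ 1) (trans (ℤP.abs-◃ _ _) (+-identityʳ _))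

G[p/q]≡m : ∀ {m p q} .{{_ : NonZero p}} .{{_ : NonZero q}} → suc q ≡ m * p → G (+ p /ℚ q) ≡ m
G[p/q]≡m {m} {suc p} {suc q} eq = begin
  G (+ suc p /ℚ suc q)          ≡⟨ cong G (ℚP.normalize-coprime coprime) ⟩
  G (mkℚ +[1+ p ] q coprime)    ≡⟨ G-mkℚ p q coprime ⟩
  suc q / suc p + 1             ≡⟨ 1+n≡m*d⇒n/d+1≡m eq ⟩
  m                             ∎
  where
  open ≡-Reasoning
  coprime : Coprime (suc p) (suc q)
  coprime = ∣1+n⇒coprime (divides m eq)

G[1/n]≡1+n : ∀ n .{{_ : NonZero n}} → G (inv n) ≡ suc n
G[1/n]≡1+n (suc n) = G[p/q]≡m {p = 1} (sym (*-identityʳ (suc (suc n))))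

toℚᵘ-homo‿∸ : ∀ x y → toℚᵘ (x - y) ℚᵘ.≃ toℚᵘ x ℚᵘ.- toℚᵘ y
toℚᵘ-homo‿∸ x y =
  ℚᵘP.≃-trans (ℚP.toℚᵘ-homo-+ x (- y)) (ℚᵘP.+-congʳ (toℚᵘ x) (ℚP.toℚᵘ-homo‿- y))

p/q-1/m≡1/[q*m] : ∀ {m p q} .{{_ : NonZero p}} .{{_ : NonZero q}} →
  suc q ≡ m * p → + p /ℚ q - inv m ≡ inv (q * m)
p/q-1/m≡1/[q*m] {suc m} {suc p} {suc q} eq = ℚP.toℚᵘ-injective (let open ℚᵘP.≃-Reasoning in begin
  toℚᵘ (fromℚᵘ u - fromℚᵘ v)            ≈⟨ toℚᵘ-homo‿∸ (fromℚᵘ u) (fromℚᵘ v) ⟩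
  toℚᵘ (fromℚᵘ u) ℚᵘ.- toℚᵘ (fromℚᵘ v)  ≈⟨ ℚᵘP.+-cong (ℚP.toℚᵘ-fromℚᵘ u) (ℚᵘP.-‿cong (ℚP.toℚᵘ-fromℚᵘ v)) ⟩
  u ℚᵘ.- v                              ≈⟨ *≡* (cong (ℤ._* ℚᵘ.↧ w) numerator) ⟩
  w                                     ≈⟨ ℚᵘP.≃-sym (ℚP.toℚᵘ-fromℚᵘ w) ⟩
  toℚᵘ (fromℚᵘ w)                       ∎)
  where
  u v w : ℚᵘ.ℚᵘ
  u = mkℚᵘ (+ suc p) q
  v = mkℚᵘ (+ 1) m
  w = mkℚᵘ (+ 1) (pred (suc q * suc m))
  numerator : ℚᵘ.↥ (u ℚᵘ.- v) ≡ + 1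
  numerator = begin
    suc p * suc m ⊖ suc (q + 0)  ≡⟨ cong₂ _⊖_ (trans (*-comm (suc p) (suc m)) (sym eq)) (cong suc (+-identityʳ q)) ⟩
    suc (suc q) ⊖ suc q          ≡⟨ ℤP.⊖-≥ (n≤1+n (suc q)) ⟩
    + (suc (suc q) ∸ suc q)      ≡⟨ cong +_ (m+n∸n≡m 1 (suc q)) ⟩
    + 1                          ∎
    where open ≡-Reasoning

1/n-1/[1+n]≡1/[n*[1+n]] : ∀ n .{{_ : NonZero n}} → inv n - inv (suc n) ≡ inv (n * suc n)
1/n-1/[1+n]≡1/[n*[1+n]] (suc n) = p/q-1/m≡1/[q*m] {suc (suc n)} {1} (sym (*-identityʳ (suc (suc n))))

sumInv+rem≡θ : ∀ θ k → sumInv θ k +ℚ rem θ k ≡ θ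
sumInv+rem≡θ θ zero = ℚP.+-identityˡ θ
sumInv+rem≡θ θ (suc k) = begin
  (S +ℚ a) +ℚ (R - a)  ≡⟨ ℚP.+-assoc S a (R - a) ⟩
  S +ℚ (a +ℚ (R - a))  ≡⟨ cong (S +ℚ_) (trans (sym (ℚP.+-assoc a R (- a))) (xyx⁻¹≈y a R)) ⟩
  S +ℚ R               ≡⟨ sumInv+rem≡θ θ k ⟩
  θ                    ∎
  where
  open ≡-Reasoning
  S = sumInv θ k
  R = rem θ k
  a = inv (greedy θ (suc k))

greedy-after-unit-remainder : ∀ θ k n .{{_ : NonZero n}} → rem θ k ≡ inv n →
  greedy θ (suc k) ≡ suc n × rem θ (suc k) ≡ inv (n * suc n)
greedy-after-unit-remainder θ k n r≡1/n = a≡1+n , (begin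
  rem θ k - inv (greedy θ (suc k))  ≡⟨ cong₂ (λ r a → r - inv a) r≡1/n a≡1+n ⟩
  inv n - inv (suc n)               ≡⟨ 1/n-1/[1+n]≡1/[n*[1+n]] n ⟩
  inv (n * suc n)                   ∎)
  where
  open ≡-Reasoning
  a≡1+n : greedy θ (suc k) ≡ suc n
  a≡1+n = trans (cong G r≡1/n) (G[1/n]≡1+n n)

module GreedyOfDivisorFraction
  (p q m : ℕ) .{{_ : NonZero p}} .{{_ : NonZero q}} (1+q≡m*p : suc q ≡ m * p) where

  θ : ℚ
  θ = + p /ℚ q

  instance
    m≢0 : NonZero m
    m≢0 = m*n≢0⇒m≢0 m {{subst NonZero 1+q≡m*p _}}

  first-term : greedy θ 1 ≡ m
  first-term = G[p/q]≡m 1+q≡m*p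

  unit-remainder : ∀ k → NonZero (prodA θ (suc k)) × rem θ (suc k) ≡ inv (q * prodA θ (suc k))
  unit-remainder zero = subst NonZero (sym prodA≡m) m≢0 , (begin
    θ - inv (greedy θ 1)  ≡⟨ cong (λ a → θ - inv a) first-term ⟩
    θ - inv m             ≡⟨ p/q-1/m≡1/[q*m] 1+q≡m*p ⟩
    inv (q * m)           ≡⟨ cong (λ a → inv (q * a)) (sym prodA≡m) ⟩
    inv (q * prodA θ 1)   ∎)
    where
    open ≡-Reasoning
    prodA≡m : prodA θ 1 ≡ m
    prodA≡m = trans (*-identityˡ (greedy θ 1)) first-term
  unit-remainder (suc k) = subst NonZero (sym prodA≡P*[1+N]) (m*n≢0 P (suc N)) , (begin
    rem θ (suc (suc k))              ≡⟨ proj₂ step ⟩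
    inv (N * suc N)                  ≡⟨ cong inv (*-assoc q P (suc N)) ⟩
    inv (q * (P * suc N))            ≡⟨ cong (λ a → inv (q * a)) (sym prodA≡P*[1+N]) ⟩
    inv (q * prodA θ (suc (suc k)))  ∎)
    where
    open ≡-Reasoning
    P N : ℕ
    P = prodA θ (suc k)
    N = q * P
    instance
      P≢0 : NonZero P
      P≢0 = proj₁ (unit-remainder k)
      N≢0 : NonZero N
      N≢0 = m*n≢0 q P
    step : greedy θ (suc (suc k)) ≡ suc N × rem θ (suc (suc k)) ≡ inv (N * suc N)
    step = greedy-after-unit-remainder θ (suc k) N (proj₂ (unit-remainder k))
    prodA≡P*[1+N] : prodA θ (suc (suc k)) ≡ P * suc N
    prodA≡P*[1+N] = cong (P *_) (proj₁ step)

  next-term : ∀ k → greedy θ (suc (suc k)) ≡ q * prodA θ (suc k) + 1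
  next-term k = trans (proj₁ (greedy-after-unit-remainder θ (suc k) N r≡1/N)) (+-comm 1 N)
    where
    N : ℕ
    N = q * prodA θ (suc k)
    instance
      P≢0 : NonZero (prodA θ (suc k))
      P≢0 = proj₁ (unit-remainder k)
      N≢0 : NonZero N
      N≢0 = m*n≢0 q (prodA θ (suc k))
    r≡1/N : rem θ (suc k) ≡ inv N
    r≡1/N = proj₂ (unit-remainder k)

  θ≡partial-sum+remainder : ∀ k → θ ≡ sumInv θ (suc k) +ℚ inv (q * prodA θ (suc k))
  θ≡partial-sum+remainder k =
    trans (sym (sumInv+rem≡θ θ (suc k))) (cong (sumInv θ (suc k) +ℚ_) (proj₂ (unit-remainder k)))

theorem1p1 : (p q : ℕ) → .{{_ : NonZero p}} → .{{_ : NonZero q}} → p ≤ q → p ∣ suc q →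
    (greedy ((+ p) /ℚ q) 1 ≡ suc q / p)
    × ((k : ℕ) → 1 ≤ k →
        (greedy ((+ p) /ℚ q) (suc k) ≡ q * prodA ((+ p) /ℚ q) k + 1)
        × ((+ p) /ℚ q ≡ sumInv ((+ p) /ℚ q) k +ℚ inv (q * prodA ((+ p) /ℚ q) k)))
theorem1p1 p q _ (divides m 1+q≡m*p) = trans first-term (sym [1+q]/p≡m) , later-terms
  where
  open GreedyOfDivisorFraction p q m 1+q≡m*p
  [1+q]/p≡m : suc q / p ≡ m
  [1+q]/p≡m = trans (cong (_/ p) 1+q≡m*p) (m*n/n≡m m p)
  later-terms : (k : ℕ) → 1 ≤ k →
    (greedy θ (suc k) ≡ q * prodA θ k + 1) × (θ ≡ sumInv θ k +ℚ inv (q * prodA θ k))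
  later-terms (suc k) _ = next-term k , θ≡partial-sum+remainder k
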